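{- Let $G$ be a 3-connected graph, $G'$ a graph, and $f$ a circuit injection from $G$ onto $G'$. Let $w$ be a vertex of $G'$ and $S(w)$ its star. Then $f^{ -1}(S(w))$ is either a star subgraph $S(v)$ of $G$ (for some vertex $v$ of $G$) or an independent (pairwise nonadjacent) set of edges of $G$.
   Context: Graphs are undirected, finite or infinite, without loops or multiple edges; a circuit is a (finite) cycle, regarded as its set of edges. For a vertex $v$, the star subgraph $S(v)$ is the set of all edges incident to $v$. A circuit injection from $G$ onto $G'$ is a one-to-one map $f$ from the edge set of $G$ onto the edge set of $G'$ such that $f(C)$ is a circuit of $G'$ whenever $C$ is a circuit of $G$; "onto $G'$" includes the requirement that $G'$ has no isolated vertices. -}

module Defs where

open import Level using (0ℓ)
open import Data.Nat using (ℕ; zero; suc; _<_; _≤_; _%_)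
open import Data.Nat.DivMod using (m%n<n)
open import Data.Fin using (Fin; toℕ; fromℕ<)
open import Data.Product using (Σ; ∃; ∃-syntax; _×_; _,_)
open import Data.Sum using (_⊎_)
open import Relation.Binary.PropositionalEquality using (_≡_; _≢_)
open import Relation.Nullary using (¬_)
open import Function.Definitions using (Injective; Surjective)
open import Function.Bundles using (_⇔_)

record Graph : Set₁ where
  field
    V    : Set
    E    : Set
    end₁ : E → V
    end₂ : E → V

  Joins : E → V → V → Set
  Joins e u v = (end₁ e ≡ u × end₂ e ≡ v) ⊎ (end₁ e ≡ v × end₂ e ≡ u)

  Inc : E → V → Set
  Inc e v = end₁ e ≡ v ⊎ end₂ e ≡ v

  Adj : V → V → Set
  Adj u v = ∃[ e ] Joins e u v

  field
    loopless : ∀ e → end₁ e ≢ end₂ e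
    simple   : ∀ e e' u v → Joins e u v → Joins e' u v → e ≡ e'

open Graph public

cyc : ∀ {n} → Fin (suc n) → Fin (suc n)
cyc {n} i = fromℕ< (m%n<n (suc (toℕ i)) (suc n))

EdgeSet : Graph → Set₁
EdgeSet G = E G → Set

IsCircuit : (G : Graph) → EdgeSet G → Set
IsCircuit G C =
  Σ ℕ λ m → (3 ≤ suc m) ×
  Σ (Fin (suc m) → V G) λ vs → Injective _≡_ _≡_ vs ×
  Σ (Fin (suc m) → E G) λ es →
    (∀ i → Joins G (es i) (vs i) (vs (cyc i))) ×
    (∀ e → C e ⇔ (∃[ i ] es i ≡ e))

Star : (G : Graph) → V G → EdgeSet G
Star G v e = Inc G e v

Image : (G G' : Graph) → (E G → E G') → EdgeSet G → EdgeSet G'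
Image G G' f C e' = ∃[ e ] (C e × f e ≡ e')

Preimage : (G G' : Graph) → (E G → E G') → EdgeSet G' → EdgeSet G
Preimage G G' f D e = D (f e)

record CircuitInjectionOnto (G G' : Graph) (f : E G → E G') : Set₁ where
  field
    injective     : Injective _≡_ _≡_ f
    surjective    : Surjective _≡_ _≡_ f
    circuits      : ∀ C → IsCircuit G C → IsCircuit G' (Image G G' f C)
    noIsolated    : ∀ w → ∃[ e ] Inc G' e w

WalkAvoiding : (G : Graph) → (V G → Set) → V G → V G → Set
WalkAvoiding G X u v =
  Σ ℕ λ n → Σ (Fin (suc n) → V G) λ ws →
    (ws Fin.zero ≡ u) × (ws (Data.Fin.fromℕ n) ≡ v) ×
    (∀ i → ¬ X (ws i)) ×
    (∀ (i : Fin n) → Adj G (ws (Data.Fin.inject₁ i)) (ws (Fin.suc i)))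
  where import Data.Fin

KConnected : ℕ → Graph → Set
KConnected k G =
  (Σ (Fin (suc k) → V G) λ vs → Injective _≡_ _≡_ vs) ×
  (∀ j → j < k → (xs : Fin j → V G) → ∀ u v →
     ¬ (∃[ i ] xs i ≡ u) → ¬ (∃[ i ] xs i ≡ v) →
     WalkAvoiding G (λ x → ∃[ i ] xs i ≡ x) u v)

Independent : (G : Graph) → EdgeSet G → Set
Independent G D = ∀ e e' → D e → D e' → e ≢ e' → ∀ x → Inc G e x → ¬ Inc G e' x

module Submission where

-- Every circuit of G′ through w uses exactly two edges of the star S(w), so a cycle of G
-- contains no edge of D = f⁻¹(S(w)) or at least two, and never three.  Suppose two edges
-- e₁ = uv₁ and e₂ = uv₂ of D share u, and call x clean if no cycle through x avoiding u
-- contains an edge of D.  As G − {u, y} is connected, a cycle through v₁ avoiding u that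
-- contained an edge k of D could be rerouted through e₁ and e₂ into a cycle containing k,
-- e₁ and e₂; so v₁ is clean, and the same rerouting carries cleanness along the edges of the
-- connected graph G − u.  Every edge missing u lies on a cycle avoiding u, hence D ⊆ S(u);
-- conversely an edge e at u lies on a cycle with e₁ whose other edges miss u, and the second
-- edge of D on that cycle can only be e.

open import Defs
open import Axiom.ExcludedMiddle using (ExcludedMiddle)
open import Level using (0ℓ)
open import Data.Nat using (ℕ; zero; suc; _<_; _≤_; _+_; _%_; s≤s; z≤n; s≤s⁻¹)
open import Data.Nat.Properties using (m≤n⇒m<n∨m≡n; m≤n⇒m≤1+n; <-irrefl; suc-injective; +-comm; +-mono-≤; m≢1+n+m; <⇒≢; ≤-trans)
open import Data.Nat.DivMod using (m<n⇒m%n≡m; n%n≡0)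
open import Data.Fin using (Fin; toℕ; fromℕ<; fromℕ; inject₁) renaming (zero to fzero; suc to fsuc)
open import Data.Fin.Properties using (toℕ-injective; toℕ<n; toℕ-fromℕ<; toℕ-fromℕ; toℕ-inject₁; pigeonhole)
open import Data.Product using (Σ; ∃-syntax; _×_; _,_; proj₁; proj₂)
open import Data.Sum using (_⊎_; inj₁; inj₂)
open import Data.Empty using (⊥; ⊥-elim)
open import Data.Unit using (⊤; tt)
open import Relation.Binary.PropositionalEquality using (_≡_; _≢_; refl; sym; trans; cong; subst)
open import Relation.Nullary using (¬_; yes; no)
open import Function.Bundles using (_⇔_; mk⇔; Equivalence)
open import Function.Definitions using (Injective)

toℕ-cyc : ∀ {n} (i : Fin (suc n)) →
  (toℕ i < n × toℕ (cyc i) ≡ suc (toℕ i)) ⊎ (toℕ i ≡ n × toℕ (cyc i) ≡ 0)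
toℕ-cyc {n} i with m≤n⇒m<n∨m≡n (s≤s⁻¹ (toℕ<n i))
... | inj₁ i<n = inj₁ (i<n , trans (toℕ-fromℕ< _) (m<n⇒m%n≡m (s≤s i<n)))
... | inj₂ i≡n = inj₂ (i≡n , trans (toℕ-fromℕ< _) (trans (cong (λ k → suc k % suc n) i≡n) (n%n≡0 (suc n))))

cyc-injective : ∀ {n} → Injective _≡_ _≡_ (cyc {n})
cyc-injective {x = i} {j} eq with toℕ-cyc i | toℕ-cyc j | cong toℕ eq
... | inj₁ (_ , a) | inj₁ (_ , b) | eq′ = toℕ-injective (suc-injective (trans (sym a) (trans eq′ b)))
... | inj₁ (_ , a) | inj₂ (_ , b) | eq′ with () ← trans (sym a) (trans eq′ b)
... | inj₂ (_ , a) | inj₁ (_ , b) | eq′ with () ← trans (sym a) (trans eq′ b)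
... | inj₂ (i≡n , _) | inj₂ (j≡n , _) | _ = toℕ-injective (trans i≡n (sym j≡n))

cyc-cyc≢ : ∀ {n} → 2 ≤ n → (i : Fin (suc n)) → cyc (cyc i) ≢ i
cyc-cyc≢ {n} 2≤n i eq with toℕ-cyc i | toℕ-cyc (cyc i) | cong toℕ eq
... | inj₁ (_ , a) | inj₁ (_ , b) | e = m≢1+n+m (toℕ i) (trans (sym e) (trans b (cong suc a)))
... | inj₁ (_ , a) | inj₂ (x , b) | e = <⇒≢ 2≤n (trans (sym (cong suc (trans (sym e) b))) (trans (sym a) x))
... | inj₂ (x , a) | inj₁ (_ , b) | e = <⇒≢ 2≤n (trans (sym (trans b (cong suc a))) (trans e x))
... | inj₂ (_ , a) | inj₂ (y , _) | _ = <⇒≢ (≤-trans (s≤s z≤n) 2≤n) (trans (sym a) y)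

cycPred : ∀ {n} → Fin (suc n) → Fin (suc n)
cycPred {n} fzero = fromℕ n
cycPred (fsuc i) = inject₁ i

cyc-cycPred : ∀ {n} (i : Fin (suc n)) → cyc (cycPred i) ≡ i
cyc-cycPred {n} fzero with toℕ-cyc (fromℕ n)
... | inj₁ (n<n , _) = ⊥-elim (<-irrefl (toℕ-fromℕ n) n<n)
... | inj₂ (_ , c≡0) = toℕ-injective c≡0
cyc-cycPred {suc n} (fsuc i) with toℕ-cyc (inject₁ i)
... | inj₁ (_ , c) = toℕ-injective (trans c (cong suc (toℕ-inject₁ i)))
... | inj₂ (i≡n , _) = ⊥-elim (<-irrefl (trans (sym (toℕ-inject₁ i)) i≡n) (toℕ<n i))

module Incidence (G : Graph) where

  joins-sym : ∀ {e x y} → Joins G e x y → Joins G e y x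
  joins-sym (inj₁ (a , b)) = inj₂ (a , b)
  joins-sym (inj₂ (a , b)) = inj₁ (a , b)

  joins⇒inc₁ : ∀ {e x y} → Joins G e x y → Inc G e x
  joins⇒inc₁ (inj₁ (a , _)) = inj₁ a
  joins⇒inc₁ (inj₂ (_ , b)) = inj₂ b

  joins⇒inc₂ : ∀ {e x y} → Joins G e x y → Inc G e y
  joins⇒inc₂ j = joins⇒inc₁ (joins-sym j)

  joins⇒≢ : ∀ {e x y} → Joins G e x y → x ≢ y
  joins⇒≢ {e} (inj₁ (a , b)) x≡y = loopless G e (trans a (trans x≡y (sym b)))
  joins⇒≢ {e} (inj₂ (a , b)) x≡y = loopless G e (trans a (trans (sym x≡y) (sym b)))

  inc⇒endpoint : ∀ {e x y z} → Joins G e x y → Inc G e z → z ≡ x ⊎ z ≡ y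
  inc⇒endpoint (inj₁ (a , b)) (inj₁ c) = inj₁ (trans (sym c) a)
  inc⇒endpoint (inj₁ (a , b)) (inj₂ c) = inj₂ (trans (sym c) b)
  inc⇒endpoint (inj₂ (a , b)) (inj₁ c) = inj₂ (trans (sym c) a)
  inc⇒endpoint (inj₂ (a , b)) (inj₂ c) = inj₁ (trans (sym c) b)

  inc⇒joins : ∀ {e z} → Inc G e z → ∃[ y ] Joins G e z y
  inc⇒joins {e} (inj₁ eq) = end₂ G e , inj₁ (eq , refl)
  inc⇒joins {e} (inj₂ eq) = end₁ G e , inj₂ (refl , eq)

  endpoints : ∀ e → Joins G e (end₁ G e) (end₂ G e)
  endpoints e = inj₁ (refl , refl)

  joins-endpoints : ∀ {e x y x′ y′} → Joins G e x y → Joins G e x′ y′ →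
    (x ≡ x′ × y ≡ y′) ⊎ (x ≡ y′ × y ≡ x′)
  joins-endpoints (inj₁ (a , b)) (inj₁ (c , d)) = inj₁ (trans (sym a) c , trans (sym b) d)
  joins-endpoints (inj₁ (a , b)) (inj₂ (c , d)) = inj₂ (trans (sym a) c , trans (sym b) d)
  joins-endpoints (inj₂ (a , b)) (inj₁ (c , d)) = inj₂ (trans (sym b) d , trans (sym a) c)
  joins-endpoints (inj₂ (a , b)) (inj₂ (c , d)) = inj₁ (trans (sym b) d , trans (sym a) c)

  module CircuitAt {m} (2≤m : 2 ≤ m) {vs : Fin (suc m) → V G} (vs-inj : Injective _≡_ _≡_ vs)
                   {es : Fin (suc m) → E G} (es-joins : ∀ i → Joins G (es i) (vs i) (vs (cyc i)))
                   (w : V G) where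

    EndAt : Fin (suc m) → Set
    EndAt i = w ≡ vs i ⊎ w ≡ vs (cyc i)

    endAt : ∀ i → Inc G (es i) w → EndAt i
    endAt i inc = inc⇒endpoint (es-joins i) inc

    private
      tail-tail : ∀ {i j} → w ≡ vs i → w ≡ vs j → es i ≡ es j
      tail-tail p q = cong es (vs-inj (trans (sym p) q))

      head-head : ∀ {i j} → w ≡ vs (cyc i) → w ≡ vs (cyc j) → es i ≡ es j
      head-head p q = cong es (cyc-injective (vs-inj (trans (sym p) q)))

    two-of-three : ∀ {i j k} → EndAt i → EndAt j → EndAt k → es i ≡ es j ⊎ es i ≡ es k ⊎ es j ≡ es k
    two-of-three (inj₁ p) (inj₁ q) _        = inj₁ (tail-tail p q)
    two-of-three (inj₂ p) (inj₂ q) _        = inj₁ (head-head p q)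
    two-of-three (inj₁ p) (inj₂ q) (inj₁ r) = inj₂ (inj₁ (tail-tail p r))
    two-of-three (inj₁ p) (inj₂ q) (inj₂ r) = inj₂ (inj₂ (head-head q r))
    two-of-three (inj₂ p) (inj₁ q) (inj₁ r) = inj₂ (inj₂ (tail-tail q r))
    two-of-three (inj₂ p) (inj₁ q) (inj₂ r) = inj₂ (inj₁ (head-head p r))

    es-cyc≢ : ∀ i → es (cyc i) ≢ es i
    es-cyc≢ i eq with joins-endpoints (es-joins i) (subst (λ e → Joins G e _ _) eq (es-joins (cyc i)))
    ... | inj₁ (vi≡vci , _) = joins⇒≢ (es-joins i) vi≡vci
    ... | inj₂ (vi≡vcci , _) = cyc-cyc≢ 2≤m i (vs-inj (sym vi≡vcci))

    partner : ∀ i → EndAt i → ∃[ j ] (Inc G (es j) w × es j ≢ es i)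
    partner i (inj₂ p) = cyc i , subst (Inc G (es (cyc i))) (sym p) (joins⇒inc₁ (es-joins (cyc i))) , es-cyc≢ i
    partner i (inj₁ p) =
      cycPred i ,
      subst (Inc G (es (cycPred i))) (sym (trans p (cong vs (sym (cyc-cycPred i))))) (joins⇒inc₂ (es-joins (cycPred i))) ,
      λ eq → es-cyc≢ (cycPred i) (trans (cong es (cyc-cycPred i)) (sym eq))

  circuit-no-three-at : ∀ {C} → IsCircuit G C → ∀ w {a b c} → C a → C b → C c →
    Inc G a w → Inc G b w → Inc G c w → a ≢ b → a ≢ c → b ≢ c → ⊥
  circuit-no-three-at (m , 3≤ , vs , vs-inj , es , es-joins , C⇔) w Ca Cb Cc Ia Ib Ic a≢b a≢c b≢c
    with Equivalence.to (C⇔ _) Ca | Equivalence.to (C⇔ _) Cb | Equivalence.to (C⇔ _) Cc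
  ... | i , refl | j , refl | k , refl with two-of-three (endAt i Ia) (endAt j Ib) (endAt k Ic)
    where open CircuitAt (s≤s⁻¹ 3≤) vs-inj es-joins w
  ... | inj₁ eq = a≢b eq
  ... | inj₂ (inj₁ eq) = a≢c eq
  ... | inj₂ (inj₂ eq) = b≢c eq

  circuit-partner-at : ∀ {C} → IsCircuit G C → ∀ w {a} → C a → Inc G a w →
    ∃[ b ] (C b × Inc G b w × b ≢ a)
  circuit-partner-at (m , 3≤ , vs , vs-inj , es , es-joins , C⇔) w Ca Ia with Equivalence.to (C⇔ _) Ca
  ... | i , refl with partner i (endAt i Ia)
    where open CircuitAt (s≤s⁻¹ 3≤) vs-inj es-joins w
  ... | j , Ij , ne = es j , Equivalence.from (C⇔ (es j)) (j , refl) , Ij , ne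

module Walks (G : Graph) where
  open Incidence G

  infixr 5 _++_
  infix 4 _∈V_ _∈E_

  data Walk : V G → V G → Set where
    nil  : ∀ a → Walk a a
    step : ∀ {a b c} (e : E G) → Joins G e a b → Walk b c → Walk a c

  _∈V_ : ∀ {a b} → V G → Walk a b → Set
  x ∈V nil a = x ≡ a
  x ∈V step {a} e j p = x ≡ a ⊎ x ∈V p

  _∈E_ : ∀ {a b} → E G → Walk a b → Set
  k ∈E nil _ = ⊥
  k ∈E step e j p = k ≡ e ⊎ k ∈E p

  IsPath : ∀ {a b} → Walk a b → Set
  IsPath (nil _) = ⊤
  IsPath (step {a} e j p) = ¬ (a ∈V p) × IsPath p

  length : ∀ {a b} → Walk a b → ℕ
  length (nil _) = 0
  length (step e j p) = suc (length p)

  _++_ : ∀ {a b c} → Walk a b → Walk b c → Walk a c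
  nil _ ++ q = q
  step e j p ++ q = step e j (p ++ q)

  reverse : ∀ {a b} → Walk a b → Walk b a
  reverse (nil a) = nil a
  reverse (step e j p) = reverse p ++ step e (joins-sym j) (nil _)

  start∈ : ∀ {a b} (p : Walk a b) → a ∈V p
  start∈ (nil _) = refl
  start∈ (step e j p) = inj₁ refl

  end∈ : ∀ {a b} (p : Walk a b) → b ∈V p
  end∈ (nil _) = refl
  end∈ (step e j p) = inj₂ (end∈ p)

  ∈V-++⁻ : ∀ {a b c x} (p : Walk a b) (q : Walk b c) → x ∈V p ++ q → x ∈V p ⊎ x ∈V q
  ∈V-++⁻ (nil _) q h = inj₂ h
  ∈V-++⁻ (step e j p) q (inj₁ h) = inj₁ (inj₁ h)
  ∈V-++⁻ (step e j p) q (inj₂ h) with ∈V-++⁻ p q h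
  ... | inj₁ h′ = inj₁ (inj₂ h′)
  ... | inj₂ h′ = inj₂ h′

  ∈V-++⁺ˡ : ∀ {a b c x} (p : Walk a b) (q : Walk b c) → x ∈V p → x ∈V p ++ q
  ∈V-++⁺ˡ (nil _) q refl = start∈ q
  ∈V-++⁺ˡ (step e j p) q (inj₁ h) = inj₁ h
  ∈V-++⁺ˡ (step e j p) q (inj₂ h) = inj₂ (∈V-++⁺ˡ p q h)

  ∈V-++⁺ʳ : ∀ {a b c x} (p : Walk a b) (q : Walk b c) → x ∈V q → x ∈V p ++ q
  ∈V-++⁺ʳ (nil _) q h = h
  ∈V-++⁺ʳ (step e j p) q h = inj₂ (∈V-++⁺ʳ p q h)

  ∈E-++⁻ : ∀ {a b c k} (p : Walk a b) (q : Walk b c) → k ∈E p ++ q → k ∈E p ⊎ k ∈E q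
  ∈E-++⁻ (nil _) q h = inj₂ h
  ∈E-++⁻ (step e j p) q (inj₁ h) = inj₁ (inj₁ h)
  ∈E-++⁻ (step e j p) q (inj₂ h) with ∈E-++⁻ p q h
  ... | inj₁ h′ = inj₁ (inj₂ h′)
  ... | inj₂ h′ = inj₂ h′

  ∈E-++⁺ˡ : ∀ {a b c k} (p : Walk a b) (q : Walk b c) → k ∈E p → k ∈E p ++ q
  ∈E-++⁺ˡ (step e j p) q (inj₁ h) = inj₁ h
  ∈E-++⁺ˡ (step e j p) q (inj₂ h) = inj₂ (∈E-++⁺ˡ p q h)

  ∈E-++⁺ʳ : ∀ {a b c k} (p : Walk a b) (q : Walk b c) → k ∈E q → k ∈E p ++ q
  ∈E-++⁺ʳ (nil _) q h = h
  ∈E-++⁺ʳ (step e j p) q h = inj₂ (∈E-++⁺ʳ p q h)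

  length-++ : ∀ {a b c} (p : Walk a b) (q : Walk b c) → length (p ++ q) ≡ length p + length q
  length-++ (nil _) q = refl
  length-++ (step e j p) q = cong suc (length-++ p q)

  1+1≤length-++ : ∀ {a b c} (p : Walk a b) (q : Walk b c) → 1 ≤ length p → 1 ≤ length q → 2 ≤ length (p ++ q)
  1+1≤length-++ p q 1≤p 1≤q = subst (2 ≤_) (sym (length-++ p q)) (+-mono-≤ 1≤p 1≤q)

  ∈V-reverse⁻ : ∀ {a b x} (p : Walk a b) → x ∈V reverse p → x ∈V p
  ∈V-reverse⁻ (nil a) h = h
  ∈V-reverse⁻ (step e j p) h with ∈V-++⁻ (reverse p) _ h
  ... | inj₁ h′ = inj₂ (∈V-reverse⁻ p h′)
  ... | inj₂ (inj₁ refl) = inj₂ (start∈ p)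
  ... | inj₂ (inj₂ h′) = inj₁ h′

  ∈E-reverse⁺ : ∀ {a b k} (p : Walk a b) → k ∈E p → k ∈E reverse p
  ∈E-reverse⁺ (step e j p) (inj₁ h) = ∈E-++⁺ʳ (reverse p) _ (inj₁ h)
  ∈E-reverse⁺ (step e j p) (inj₂ h) = ∈E-++⁺ˡ (reverse p) _ (∈E-reverse⁺ p h)

  ∈E⇒joins : ∀ {a b k} (p : Walk a b) → k ∈E p → ∃[ x ] ∃[ y ] (Joins G k x y × x ∈V p × y ∈V p)
  ∈E⇒joins (step {a} {b} e j p) (inj₁ refl) = a , b , j , inj₁ refl , inj₂ (start∈ p)
  ∈E⇒joins (step e j p) (inj₂ h) with ∈E⇒joins p h
  ... | x , y , jk , hx , hy = x , y , jk , inj₂ hx , inj₂ hy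

  ≢⇒1≤length : ∀ {a b} (p : Walk a b) → a ≢ b → 1 ≤ length p
  ≢⇒1≤length (nil a) a≢a = ⊥-elim (a≢a refl)
  ≢⇒1≤length (step e j p) _ = s≤s z≤n

  IsPath-++ : ∀ {a b c} (p : Walk a b) (q : Walk b c) → IsPath p → IsPath q →
    (∀ x → x ∈V p → x ∈V q → x ≡ b) → IsPath (p ++ q)
  IsPath-++ (nil _) q _ q-path _ = q-path
  IsPath-++ (step {a} e j p) q (a∉p , p-path) q-path meet =
    a∉p++q , IsPath-++ p q p-path q-path (λ x h h′ → meet x (inj₂ h) h′)
    where
    a∉p++q : ¬ (a ∈V p ++ q)
    a∉p++q h with ∈V-++⁻ p q h
    ... | inj₁ h′ = a∉p h′
    ... | inj₂ h′ = a∉p (subst (_∈V p) (sym (meet a (inj₁ refl) h′)) (end∈ p))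

  IsPath-++⁻ : ∀ {a b c} (p : Walk a b) (q : Walk b c) → IsPath (p ++ q) →
    IsPath p × IsPath q × (∀ x → x ∈V p → x ∈V q → x ≡ b)
  IsPath-++⁻ (nil _) q pq-path = tt , pq-path , λ x x≡b _ → x≡b
  IsPath-++⁻ (step {a} e j p) q (a∉pq , pq-path) with IsPath-++⁻ p q pq-path
  ... | p-path , q-path , meet = ((λ h → a∉pq (∈V-++⁺ˡ p q h)) , p-path) , q-path , meet′
    where
    meet′ : ∀ x → x ∈V step e j p → x ∈V q → x ≡ _
    meet′ x (inj₁ refl) h′ = ⊥-elim (a∉pq (∈V-++⁺ʳ p q h′))
    meet′ x (inj₂ h) h′ = meet x h h′

  IsPath-reverse : ∀ {a b} (p : Walk a b) → IsPath p → IsPath (reverse p)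
  IsPath-reverse (nil a) _ = tt
  IsPath-reverse (step {a} {b} e j p) (a∉p , p-path) =
    IsPath-++ (reverse p) (step e (joins-sym j) (nil a)) (IsPath-reverse p p-path) ((λ b≡a → joins⇒≢ j (sym b≡a)) , tt) meet
    where
    meet : ∀ x → x ∈V reverse p → x ∈V step e (joins-sym j) (nil a) → x ≡ b
    meet x _ (inj₁ x≡b) = x≡b
    meet x h (inj₂ refl) = ⊥-elim (a∉p (∈V-reverse⁻ p h))

  splitAt : ∀ {a b x} (p : Walk a b) → x ∈V p → Σ (Walk a x) λ pre → Σ (Walk x b) λ suf → pre ++ suf ≡ p
  splitAt (nil a) refl = nil a , nil a , refl
  splitAt (step {a} e j p) (inj₁ refl) = nil a , step e j p , refl
  splitAt (step e j p) (inj₂ h) with splitAt p h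
  ... | pre , suf , eq = step e j pre , suf , cong (step e j) eq

  splitLast : ∀ {a b c} e (j : Joins G e a b) (q : Walk b c) →
    ∃[ y ] Σ (Walk a y) λ ini → Σ (E G) λ el → Σ (Joins G el y c) λ jl → step e j q ≡ ini ++ step el jl (nil c)
  splitLast {a} e j (nil b) = a , nil a , e , j , refl
  splitLast e j (step e′ j′ q) with splitLast e′ j′ q
  ... | y , ini , el , jl , eq = y , step e j ini , el , jl , cong (step e j) eq

  module _ (em : ExcludedMiddle 0ℓ) where

    firstHit : ∀ (Q : V G → Set) {s t} (p : Walk s t) → Q t →
      ∃[ c ] (Q c × Σ (Walk s c) λ pre → (∀ v → v ∈V pre → v ∈V p) × (∀ v → v ∈V pre → Q v → v ≡ c))
    firstHit Q (nil t) qt = t , qt , nil t , (λ v h → h) , (λ v eq _ → eq)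
    firstHit Q (step {a} e j p) qt with em {Q a}
    ... | yes qa = a , qa , nil a , (λ v eq → inj₁ eq) , (λ v eq _ → eq)
    ... | no ¬qa with firstHit Q p qt
    ... | c , qc , pre , pre⊆p , first = c , qc , step e j pre , ⊆-step , first′
      where
      ⊆-step : ∀ v → v ∈V step e j pre → v ∈V step e j p
      ⊆-step v (inj₁ eq) = inj₁ eq
      ⊆-step v (inj₂ h) = inj₂ (pre⊆p v h)
      first′ : ∀ v → v ∈V step e j pre → Q v → v ≡ c
      first′ v (inj₁ refl) qv = ⊥-elim (¬qa qv)
      first′ v (inj₂ h) qv = first v h qv

    toPath : ∀ {a b} (p : Walk a b) → Σ (Walk a b) λ q → IsPath q × (∀ v → v ∈V q → v ∈V p)
    toPath (nil a) = nil a , tt , λ v h → h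
    toPath (step {a} e j p) with toPath p
    ... | q , q-path , q⊆p with em {a ∈V q}
    ... | no a∉q = step e j q , (a∉q , q-path) , ⊆-step
      where
      ⊆-step : ∀ v → v ∈V step e j q → v ∈V step e j p
      ⊆-step v (inj₁ eq) = inj₁ eq
      ⊆-step v (inj₂ h) = inj₂ (q⊆p v h)
    ... | yes a∈q with splitAt q a∈q
    ... | pre , suf , refl = suf , proj₁ (proj₂ (IsPath-++⁻ pre suf q-path)) ,
          λ v h → inj₂ (q⊆p v (∈V-++⁺ʳ pre suf h))

module ClosedPaths (G : Graph) where
  open Walks G

  vertexAt : ∀ {a b} → Walk a b → ℕ → V G
  vertexAt (nil a) k = a
  vertexAt (step {a} e j p) zero = a
  vertexAt (step e j p) (suc k) = vertexAt p k

  -- The closing edge d is used as the value past the end, so that edgeAt p d (length p) = d.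
  edgeAt : ∀ {a b} → Walk a b → E G → ℕ → E G
  edgeAt (nil _) d k = d
  edgeAt (step e j p) d zero = e
  edgeAt (step e j p) d (suc k) = edgeAt p d k

  vertexAt-0 : ∀ {a b} (p : Walk a b) → vertexAt p 0 ≡ a
  vertexAt-0 (nil a) = refl
  vertexAt-0 (step e j p) = refl

  vertexAt-length : ∀ {a b} (p : Walk a b) → vertexAt p (length p) ≡ b
  vertexAt-length (nil a) = refl
  vertexAt-length (step e j p) = vertexAt-length p

  edgeAt-length : ∀ {a b} (p : Walk a b) d → edgeAt p d (length p) ≡ d
  edgeAt-length (nil a) d = refl
  edgeAt-length (step e j p) d = edgeAt-length p d

  edgeAt-joins : ∀ {a b} (p : Walk a b) d k → k < length p →
    Joins G (edgeAt p d k) (vertexAt p k) (vertexAt p (suc k))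
  edgeAt-joins (step {a} e j p) d zero _ = subst (Joins G e a) (sym (vertexAt-0 p)) j
  edgeAt-joins (step e j p) d (suc k) (s≤s k<n) = edgeAt-joins p d k k<n

  vertexAt-∈ : ∀ {a b} (p : Walk a b) k → k ≤ length p → vertexAt p k ∈V p
  vertexAt-∈ (nil a) k _ = refl
  vertexAt-∈ (step e j p) zero _ = inj₁ refl
  vertexAt-∈ (step e j p) (suc k) (s≤s k≤n) = inj₂ (vertexAt-∈ p k k≤n)

  edgeAt-∈ : ∀ {a b} (p : Walk a b) d k → k < length p → edgeAt p d k ∈E p
  edgeAt-∈ (step e j p) d zero _ = inj₁ refl
  edgeAt-∈ (step e j p) d (suc k) (s≤s k<n) = inj₂ (edgeAt-∈ p d k k<n)

  ∈E⇒edgeAt : ∀ {a b} (p : Walk a b) d {k} → k ∈E p → ∃[ i ] (i < length p × edgeAt p d i ≡ k)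
  ∈E⇒edgeAt (step e j p) d (inj₁ refl) = zero , s≤s z≤n , refl
  ∈E⇒edgeAt (step e j p) d (inj₂ h) with ∈E⇒edgeAt p d h
  ... | i , i<n , eq = suc i , s≤s i<n , eq

  vertexAt-injective : ∀ {a b} (p : Walk a b) → IsPath p → ∀ {k l} → k ≤ length p → l ≤ length p →
    vertexAt p k ≡ vertexAt p l → k ≡ l
  vertexAt-injective (nil a) _ {zero} {zero} _ _ _ = refl
  vertexAt-injective (step e j p) _ {zero} {zero} _ _ _ = refl
  vertexAt-injective (step e j p) (a∉p , _) {zero} {suc l} _ (s≤s l≤n) eq =
    ⊥-elim (a∉p (subst (_∈V p) (sym eq) (vertexAt-∈ p l l≤n)))
  vertexAt-injective (step e j p) (a∉p , _) {suc k} {zero} (s≤s k≤n) _ eq =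
    ⊥-elim (a∉p (subst (_∈V p) eq (vertexAt-∈ p k k≤n)))
  vertexAt-injective (step e j p) (_ , p-path) {suc k} {suc l} (s≤s k≤n) (s≤s l≤n) eq =
    cong suc (vertexAt-injective p p-path k≤n l≤n eq)

  closed-path-isCircuit : ∀ {s t} (p : Walk s t) → IsPath p → 2 ≤ length p → ∀ d → Joins G d t s →
    IsCircuit G (λ k → k ∈E p ⊎ k ≡ d)
  closed-path-isCircuit {s} {t} p p-path 2≤n d d-joins = n , s≤s 2≤n , vs , vs-inj , es , es-joins , edges
    where
    n = length p
    vs : Fin (suc n) → V G
    vs i = vertexAt p (toℕ i)
    es : Fin (suc n) → E G
    es i = edgeAt p d (toℕ i)
    i≤n : ∀ (i : Fin (suc n)) → toℕ i ≤ n
    i≤n i = s≤s⁻¹ (toℕ<n i)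
    vs-inj : Injective _≡_ _≡_ vs
    vs-inj {i} {j} eq = toℕ-injective (vertexAt-injective p p-path (i≤n i) (i≤n j) eq)
    closing : Joins G (edgeAt p d n) (vertexAt p n) (vertexAt p 0)
    closing rewrite edgeAt-length p d | vertexAt-length p | vertexAt-0 p = d-joins
    es-joins : ∀ i → Joins G (es i) (vs i) (vs (cyc i))
    es-joins i with toℕ-cyc i
    ... | inj₁ (i<n , c) rewrite c = edgeAt-joins p d (toℕ i) i<n
    ... | inj₂ (i≡n , c) rewrite c | i≡n = closing
    edges : ∀ k → (k ∈E p ⊎ k ≡ d) ⇔ (∃[ i ] es i ≡ k)
    edges k = mk⇔ to from
      where
      to : k ∈E p ⊎ k ≡ d → ∃[ i ] es i ≡ k
      to (inj₁ h) with ∈E⇒edgeAt p d h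
      ... | i , i<n , eq = fromℕ< (m≤n⇒m≤1+n i<n) , trans (cong (edgeAt p d) (toℕ-fromℕ< _)) eq
      to (inj₂ refl) = fromℕ n , trans (cong (edgeAt p d) (toℕ-fromℕ n)) (edgeAt-length p d)
      from : ∃[ i ] es i ≡ k → k ∈E p ⊎ k ≡ d
      from (i , refl) with m≤n⇒m<n∨m≡n (i≤n i)
      ... | inj₁ i<n = inj₁ (edgeAt-∈ p d (toℕ i) i<n)
      ... | inj₂ i≡n = inj₂ (trans (cong (edgeAt p d) i≡n) (edgeAt-length p d))

module Cycles (G : Graph) where
  open Incidence G
  open Walks G
  open ClosedPaths G

  record Cycle (s : V G) : Set where
    constructor cycle
    field
      {last}        : V G
      path          : Walk s last
      path-isPath   : IsPath path
      2≤length      : 2 ≤ length path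
      closing       : E G
      closing-joins : Joins G closing last s
  open Cycle public

  infix 4 _∈Vᶜ_ _∈Eᶜ_

  _∈Vᶜ_ : ∀ {s} → V G → Cycle s → Set
  v ∈Vᶜ c = v ∈V path c

  _∈Eᶜ_ : ∀ {s} → E G → Cycle s → Set
  k ∈Eᶜ c = k ∈E path c ⊎ k ≡ closing c

  isCircuit : ∀ {s} (c : Cycle s) → IsCircuit G (_∈Eᶜ c)
  isCircuit c = closed-path-isCircuit (path c) (path-isPath c) (2≤length c) (closing c) (closing-joins c)

  ∈Eᶜ⇒joins : ∀ {s k} (c : Cycle s) → k ∈Eᶜ c → ∃[ x ] ∃[ y ] (Joins G k x y × x ∈Vᶜ c × y ∈Vᶜ c)
  ∈Eᶜ⇒joins c (inj₁ h) = ∈E⇒joins (path c) h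
  ∈Eᶜ⇒joins c (inj₂ refl) = last c , _ , closing-joins c , end∈ (path c) , start∈ (path c)

  Avoids : ∀ {s} → Cycle s → V G → Set
  Avoids c u = ∀ v → v ∈Vᶜ c → v ≢ u

  avoids⇒≢ : ∀ {s u} (c : Cycle s) → Avoids c u → ∀ {k e} → k ∈Eᶜ c → Inc G e u → k ≢ e
  avoids⇒≢ c avoids k∈c ie refl with ∈Eᶜ⇒joins c k∈c
  ... | x , y , jk , x∈c , y∈c with inc⇒endpoint jk ie
  ... | inj₁ u≡x = avoids x x∈c (sym u≡x)
  ... | inj₂ u≡y = avoids y y∈c (sym u≡y)

  Rotation : ∀ {s} → Cycle s → V G → Set
  Rotation c y = Σ (Cycle y) λ c′ → (∀ v → v ∈Vᶜ c′ → v ∈Vᶜ c) × (∀ k → k ∈Eᶜ c → k ∈Eᶜ c′)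

  -- Cutting the path s ⋯ y′ –el– y ⋯ t at el and gluing at the closing edge d gives y ⋯ t –d– s ⋯ y′.
  rotate-at : ∀ {s y y′} (c : Cycle s) (ini : Walk s y′) el (jl : Joins G el y′ y) (suf : Walk y (last c)) →
    path c ≡ (ini ++ step el jl (nil y)) ++ suf → Rotation c y
  rotate-at {s} {y} {y′} (cycle {t} _ p-path 2≤p d jd) ini el jl suf refl =
    cycle new new-path 2≤new el jl , new⊆ , ⊆new
    where
    L : Walk y′ y
    L = step el jl (nil y)
    new : Walk y y′
    new = suf ++ step d jd ini
    ini-split : IsPath ini × IsPath L × (∀ v → v ∈V ini → v ∈V L → v ≡ y′)
    ini-split = IsPath-++⁻ ini L (proj₁ (IsPath-++⁻ (ini ++ L) suf p-path))
    suf-path : IsPath suf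
    suf-path = proj₁ (proj₂ (IsPath-++⁻ (ini ++ L) suf p-path))
    y∉ini : ¬ (y ∈V ini)
    y∉ini h = joins⇒≢ jl (sym (proj₂ (proj₂ ini-split) y h (inj₂ refl)))
    ini∩suf : ∀ {x} → x ∈V ini → ¬ (x ∈V suf)
    ini∩suf {x} hi hs = y∉ini (subst (_∈V ini) (proj₂ (proj₂ (IsPath-++⁻ (ini ++ L) suf p-path)) x (∈V-++⁺ˡ ini L hi) hs) hi)
    new-path : IsPath new
    new-path = IsPath-++ suf (step d jd ini) suf-path ((λ h → ini∩suf h (end∈ suf)) , proj₁ ini-split) meet
      where
      meet : ∀ x → x ∈V suf → x ∈V step d jd ini → x ≡ t
      meet x hs (inj₁ eq) = eq
      meet x hs (inj₂ hi) = ⊥-elim (ini∩suf hi hs)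
    2≤new : 2 ≤ length new
    2≤new = subst (2 ≤_) same-length 2≤p
      where
      same-length : length ((ini ++ L) ++ suf) ≡ length new
      same-length = trans (length-++ (ini ++ L) suf)
        (trans (cong (_+ length suf) (length-++ ini L))
        (trans (trans (+-comm (length ini + 1) (length suf)) (cong (length suf +_) (+-comm (length ini) 1)))
        (sym (length-++ suf (step d jd ini)))))
    new⊆ : ∀ v → v ∈V new → v ∈V (ini ++ L) ++ suf
    new⊆ v h with ∈V-++⁻ suf (step d jd ini) h
    ... | inj₁ h′ = ∈V-++⁺ʳ (ini ++ L) suf h′
    ... | inj₂ (inj₁ refl) = ∈V-++⁺ʳ (ini ++ L) suf (end∈ suf)
    ... | inj₂ (inj₂ h′) = ∈V-++⁺ˡ (ini ++ L) suf (∈V-++⁺ˡ ini L h′)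
    ⊆new : ∀ k → k ∈E (ini ++ L) ++ suf ⊎ k ≡ d → k ∈E new ⊎ k ≡ el
    ⊆new k (inj₂ eq) = inj₁ (∈E-++⁺ʳ suf (step d jd ini) (inj₁ eq))
    ⊆new k (inj₁ h) with ∈E-++⁻ (ini ++ L) suf h
    ... | inj₂ h′ = inj₁ (∈E-++⁺ˡ suf (step d jd ini) h′)
    ... | inj₁ h′ with ∈E-++⁻ ini L h′
    ... | inj₁ h″ = inj₁ (∈E-++⁺ʳ suf (step d jd ini) (inj₂ h″))
    ... | inj₂ (inj₁ eq) = inj₂ eq

  rotate : ∀ {s} (c : Cycle s) {y} → y ∈Vᶜ c → Rotation c y
  rotate c h with splitAt (path c) h
  ... | nil _ , _ , _ = c , (λ v h → h) , (λ k h → h)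
  ... | step e j pre , suf , eq with splitLast e j pre
  ... | _ , ini , el , jl , eq′ = rotate-at c ini el jl suf (trans (sym eq) (cong (_++ suf) eq′))

  Detour : ∀ {x y c} → Cycle y → E G → Walk x c → E G → Set
  Detour {x} K exy S k = Σ (Cycle x) λ Q →
    k ∈Eᶜ Q × (∀ v → v ∈Vᶜ Q → v ∈V S ⊎ v ∈Vᶜ K) × (∀ k′ → k′ ∈E S → k′ ∈Eᶜ Q) × exy ∈Eᶜ Q

  -- The path S from x to c, the edge x–y and one of the two arcs of K between y and c
  -- form a cycle; the arc is chosen to contain k.
  reroute-at : ∀ {x y c} (K : Cycle y) (pre : Walk y c) (suf : Walk c (last K)) → path K ≡ pre ++ suf →
    ∀ {exy} → Joins G exy x y → ¬ (x ∈Vᶜ K) → c ≢ y → (S : Walk x c) → IsPath S →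
    (∀ v → v ∈V S → v ∈Vᶜ K → v ≡ c) → ∀ {k} → k ∈Eᶜ K → Detour K exy S k
  reroute-at {x} {y} {c} K@(cycle {t} _ K-path _ d jd) pre suf refl {exy} jxy x∉K c≢y S S-path S∩K = detour
    where
    split : IsPath pre × IsPath suf × (∀ v → v ∈V pre → v ∈V suf → v ≡ c)
    split = IsPath-++⁻ pre suf K-path
    S-nonempty : 1 ≤ length S
    S-nonempty = ≢⇒1≤length S (λ x≡c → x∉K (subst (_∈V pre ++ suf) (sym x≡c) (∈V-++⁺ˡ pre suf (end∈ pre))))
    back : Cycle x
    back = cycle (S ++ reverse pre) back-path
                 (1+1≤length-++ S (reverse pre) S-nonempty (≢⇒1≤length (reverse pre) c≢y)) exy (joins-sym jxy)
      where
      back-path = IsPath-++ S (reverse pre) S-path (IsPath-reverse pre (proj₁ split))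
                    (λ v hs hr → S∩K v hs (∈V-++⁺ˡ pre suf (∈V-reverse⁻ pre hr)))
    T : Walk c y
    T = suf ++ step d jd (nil y)
    T-path : IsPath T
    T-path = IsPath-++ suf (step d jd (nil y)) (proj₁ (proj₂ split)) (joins⇒≢ jd , tt) meet
      where
      meet : ∀ v → v ∈V suf → v ∈V step d jd (nil y) → v ≡ t
      meet v hs (inj₁ eq) = eq
      meet v hs (inj₂ refl) = ⊥-elim (c≢y (sym (proj₂ (proj₂ split) v (start∈ pre) hs)))
    T⊆K : ∀ {v} → v ∈V T → v ∈V pre ++ suf
    T⊆K {v} h with ∈V-++⁻ suf (step d jd (nil y)) h
    ... | inj₁ h′ = ∈V-++⁺ʳ pre suf h′
    ... | inj₂ (inj₁ refl) = ∈V-++⁺ʳ pre suf (end∈ suf)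
    ... | inj₂ (inj₂ refl) = ∈V-++⁺ˡ pre suf (start∈ pre)
    forth : Cycle x
    forth = cycle (S ++ T) (IsPath-++ S T S-path T-path (λ v hs ht → S∩K v hs (T⊆K ht)))
                  (1+1≤length-++ S T S-nonempty (≢⇒1≤length T c≢y)) exy (joins-sym jxy)
    back⊆ : ∀ v → v ∈Vᶜ back → v ∈V S ⊎ v ∈V pre ++ suf
    back⊆ v h with ∈V-++⁻ S (reverse pre) h
    ... | inj₁ h′ = inj₁ h′
    ... | inj₂ h′ = inj₂ (∈V-++⁺ˡ pre suf (∈V-reverse⁻ pre h′))
    forth⊆ : ∀ v → v ∈Vᶜ forth → v ∈V S ⊎ v ∈V pre ++ suf
    forth⊆ v h with ∈V-++⁻ S T h
    ... | inj₁ h′ = inj₁ h′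
    ... | inj₂ h′ = inj₂ (T⊆K h′)
    detour : ∀ {k} → k ∈E pre ++ suf ⊎ k ≡ d → Detour K exy S k
    detour (inj₂ refl) = forth , inj₁ (∈E-++⁺ʳ S T (∈E-++⁺ʳ suf _ (inj₁ refl))) , forth⊆ ,
                         (λ k′ h → inj₁ (∈E-++⁺ˡ S T h)) , inj₂ refl
    detour (inj₁ h) with ∈E-++⁻ pre suf h
    ... | inj₁ h′ = back , inj₁ (∈E-++⁺ʳ S (reverse pre) (∈E-reverse⁺ pre h′)) , back⊆ ,
                    (λ k′ h → inj₁ (∈E-++⁺ˡ S (reverse pre) h)) , inj₂ refl
    ... | inj₂ h′ = forth , inj₁ (∈E-++⁺ʳ S T (∈E-++⁺ˡ suf _ h′)) , forth⊆ ,
                    (λ k′ h → inj₁ (∈E-++⁺ˡ S T h)) , inj₂ refl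

  reroute : ∀ {x y} (K : Cycle y) {exy} → Joins G exy x y → ¬ (x ∈Vᶜ K) → ∀ {c} → c ∈Vᶜ K → c ≢ y →
    (S : Walk x c) → IsPath S → (∀ v → v ∈V S → v ∈Vᶜ K → v ≡ c) → ∀ {k} → k ∈Eᶜ K → Detour K exy S k
  reroute K jxy x∉K c∈K with splitAt (path K) c∈K
  ... | pre , suf , eq = reroute-at K pre suf (sym eq) jxy x∉K

module ThreeConnected (em : ExcludedMiddle 0ℓ) (G : Graph) (conn : KConnected 3 G) where
  open Incidence G
  open Walks G
  open Cycles G

  private
    fromIndexed : ∀ n (ws : Fin (suc n) → V G) → (∀ (i : Fin n) → Adj G (ws (inject₁ i)) (ws (fsuc i))) →
      Σ (Walk (ws fzero) (ws (fromℕ n))) λ p → ∀ v → v ∈V p → ∃[ i ] ws i ≡ v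
    fromIndexed zero ws adj = nil _ , λ v eq → fzero , sym eq
    fromIndexed (suc n) ws adj with adj fzero | fromIndexed n (λ i → ws (fsuc i)) (λ i → adj (fsuc i))
    ... | e , j | p , p⊆ws = step e j p , ⊆ws
      where
      ⊆ws : ∀ v → v ∈V step e j p → ∃[ i ] ws i ≡ v
      ⊆ws v (inj₁ eq) = fzero , sym eq
      ⊆ws v (inj₂ h) with p⊆ws v h
      ... | i , eq = fsuc i , eq

    fromWalkAvoiding : ∀ {X : V G → Set} {a b} → WalkAvoiding G X a b → Σ (Walk a b) λ p → ∀ v → v ∈V p → ¬ X v
    fromWalkAvoiding {X} (n , ws , refl , refl , avoids , adj) with fromIndexed n ws adj
    ... | p , p⊆ws = p , λ v h → let (i , eq) = p⊆ws v h in subst (λ z → ¬ X z) eq (avoids i)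

    pair : V G → V G → Fin 2 → V G
    pair X Y fzero = X
    pair X Y (fsuc _) = Y

    ∉pair : ∀ {X Y a} → a ≢ X → a ≢ Y → ¬ (∃[ i ] pair X Y i ≡ a)
    ∉pair a≢X a≢Y (fzero , eq) = a≢X (sym eq)
    ∉pair a≢X a≢Y (fsuc fzero , eq) = a≢Y (sym eq)

    four : Fin 4 → V G
    four = proj₁ (proj₁ conn)

    four-injective : Injective _≡_ _≡_ four
    four-injective = proj₂ (proj₁ conn)

  path-avoiding : ∀ X Y {a b} → a ≢ X → a ≢ Y → b ≢ X → b ≢ Y →
    Σ (Walk a b) λ p → IsPath p × (∀ v → v ∈V p → v ≢ X × v ≢ Y)
  path-avoiding X Y {a} {b} a≢X a≢Y b≢X b≢Y
    with fromWalkAvoiding {X = λ v → ∃[ i ] pair X Y i ≡ v} (proj₂ conn 2 (s≤s (s≤s (s≤s z≤n))) (pair X Y) a b (∉pair a≢X a≢Y) (∉pair b≢X b≢Y))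
  ... | p , avoids with toPath em p
  ... | q , q-path , q⊆p = q , q-path , λ v h → (λ v≡X → avoids v (q⊆p v h) (fzero , sym v≡X))
                                                , (λ v≡Y → avoids v (q⊆p v h) (fsuc fzero , sym v≡Y))

  fourth-vertex : ∀ a b c → ∃[ x ] (x ≢ a × x ≢ b × x ≢ c)
  fourth-vertex a b c with em {∃[ i ] (four i ≢ a × four i ≢ b × four i ≢ c)}
  ... | yes (i , ne) = four i , ne
  ... | no none =
    let i , j , i<j , same = pigeonhole (s≤s (s≤s (s≤s (s≤s z≤n)))) (λ i → proj₁ (classify i))
    in ⊥-elim (<-irrefl (cong toℕ (four-injective (trans (proj₂ (classify i)) (trans (cong abc same) (sym (proj₂ (classify j))))))) i<j)
    where
    abc : Fin 3 → V G
    abc fzero = a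
    abc (fsuc fzero) = b
    abc (fsuc (fsuc _)) = c
    classify : ∀ i → ∃[ k ] four i ≡ abc k
    classify i with em {four i ≡ a} | em {four i ≡ b} | em {four i ≡ c}
    ... | yes p | _ | _ = fzero , p
    ... | no _ | yes p | _ = fsuc fzero , p
    ... | no _ | no _ | yes p = fsuc (fsuc fzero) , p
    ... | no p | no q | no r = ⊥-elim (none (i , p , q , r))

  path-onto : ∀ {s t} X Y (K : Walk s t) {a} → a ≢ X → a ≢ Y → t ≢ X → t ≢ Y →
    ∃[ c ] (c ∈V K × Σ (Walk a c) λ S →
      IsPath S × (∀ v → v ∈V S → v ≢ X × v ≢ Y) × (∀ v → v ∈V S → v ∈V K → v ≡ c))
  path-onto X Y K a≢X a≢Y t≢X t≢Y with path-avoiding X Y a≢X a≢Y t≢X t≢Y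
  ... | p , _ , avoids with firstHit em (_∈V K) p (end∈ K)
  ... | c , c∈K , pre , pre⊆p , first with toPath em pre
  ... | S , S-path , S⊆pre = c , c∈K , S , S-path , (λ v h → avoids v (pre⊆p v (S⊆pre v h))) ,
                              (λ v h h′ → first v (S⊆pre v h) h′)

  -- Through a fourth vertex, a has a neighbour a′ ∉ {u, b}; a path from a′ to b in G − {u, a}
  -- closes the cycle.
  cycle-avoiding : ∀ u {k a b} → Joins G k a b → a ≢ u → b ≢ u → Σ (Cycle a) λ c → k ∈Eᶜ c × Avoids c u
  cycle-avoiding u {k} {a} {b} jk a≢u b≢u with fourth-vertex u a b
  ... | x , x≢u , x≢a , x≢b with path-avoiding u b a≢u (joins⇒≢ jk) x≢u x≢b
  ... | nil _ , _ , _ = ⊥-elim (x≢a refl)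
  ... | step {_} {a′} e′ j′ T , _ , T-avoids with T-avoids a′ (inj₂ (start∈ T))
  ... | a′≢u , a′≢b with path-avoiding u a a′≢u (λ a′≡a → joins⇒≢ j′ (sym a′≡a)) b≢u (λ b≡a → joins⇒≢ jk (sym b≡a))
  ... | W , W-path , W-avoids =
    cycle (step e′ j′ W) ((λ h → proj₂ (W-avoids a h) refl) , W-path) (s≤s (≢⇒1≤length W a′≢b)) k (joins-sym jk) ,
    inj₂ refl , avoids
    where
    avoids : ∀ v → v ∈V step e′ j′ W → v ≢ u
    avoids v (inj₁ refl) = a≢u
    avoids v (inj₂ h) = proj₁ (W-avoids v h)

module StarPreimage (em : ExcludedMiddle 0ℓ) (G G′ : Graph) (conn : KConnected 3 G)
                    {f : E G → E G′} (ci : CircuitInjectionOnto G G′ f) (w : V G′) where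
  open Incidence G
  open Walks G
  open Cycles G
  open ThreeConnected em G conn
  open CircuitInjectionOnto ci

  Pre : EdgeSet G
  Pre = Preimage G G′ f (Star G′ w)

  preimage-partner : ∀ {s} (c : Cycle s) {a} → a ∈Eᶜ c → Pre a → ∃[ b ] (b ∈Eᶜ c × Pre b × b ≢ a)
  preimage-partner c a∈c Pa with Incidence.circuit-partner-at G′ (circuits _ (isCircuit c)) w (_ , a∈c , refl) Pa
  ... | _ , (b , b∈c , refl) , Pb , fb≢fa = b , b∈c , Pb , λ b≡a → fb≢fa (cong f b≡a)

  preimage-no-three : ∀ {s} (c : Cycle s) {a b d} → a ∈Eᶜ c → b ∈Eᶜ c → d ∈Eᶜ c → Pre a → Pre b → Pre d →
    a ≢ b → a ≢ d → b ≢ d → ⊥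
  preimage-no-three c a∈c b∈c d∈c Pa Pb Pd a≢b a≢d b≢d =
    Incidence.circuit-no-three-at G′ (circuits _ (isCircuit c)) w (_ , a∈c , refl) (_ , b∈c , refl) (_ , d∈c , refl)
      Pa Pb Pd (λ eq → a≢b (injective eq)) (λ eq → a≢d (injective eq)) (λ eq → b≢d (injective eq))

  module AtSharedVertex {u v₁ v₂ e₁ e₂} (j₁ : Joins G e₁ u v₁) (j₂ : Joins G e₂ u v₂)
                        (Pe₁ : Pre e₁) (Pe₂ : Pre e₂) (e₁≢e₂ : e₁ ≢ e₂) where

    Clean : V G → Set
    Clean x = ∀ {s} (c : Cycle s) → x ∈Vᶜ c → Avoids c u → ∀ {k} → k ∈Eᶜ c → ¬ Pre k

    v₁≢u : v₁ ≢ u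
    v₁≢u v₁≡u = joins⇒≢ j₁ (sym v₁≡u)

    v₂≢u : v₂ ≢ u
    v₂≢u v₂≡u = joins⇒≢ j₂ (sym v₂≡u)

    v₂≢v₁ : v₂ ≢ v₁
    v₂≢v₁ refl = e₁≢e₂ (simple G e₁ e₂ u v₁ j₁ j₂)

    rooted⇒clean : ∀ {x} → (∀ (K : Cycle x) → Avoids K u → ∀ {k} → k ∈Eᶜ K → ¬ Pre k) → Clean x
    rooted⇒clean rooted K x∈K avoids k∈K with rotate K x∈K
    ... | K′ , K′⊆K , K⊆K′ = rooted K′ (λ v h → avoids v (K′⊆K v h)) (K⊆K′ _ k∈K)

    -- Rerouting K through e₁ and e₂ would put k, e₁ and e₂ on a common cycle.
    clean-v₁ : Clean v₁
    clean-v₁ = rooted⇒clean go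
      where
      go : ∀ (K : Cycle v₁) → Avoids K u → ∀ {k} → k ∈Eᶜ K → ¬ Pre k
      go K avoids k∈K Pk
        with path-onto u v₁ (path K) v₂≢u v₂≢v₁ (avoids _ (end∈ (path K))) (joins⇒≢ (closing-joins K))
      ... | c , c∈K , R , R-path , R-avoids , R∩K
        with reroute K j₁ (λ h → avoids u h refl) c∈K (proj₂ (R-avoids c (end∈ R))) (step e₂ j₂ R) S-path S∩K k∈K
        where
        S-path : IsPath (step e₂ j₂ R)
        S-path = (λ h → proj₁ (R-avoids u h) refl) , R-path
        S∩K : ∀ v → v ∈V step e₂ j₂ R → v ∈Vᶜ K → v ≡ c
        S∩K v (inj₁ refl) h = ⊥-elim (avoids v h refl)
        S∩K v (inj₂ h) h′ = R∩K v h h′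
      ... | Q , k∈Q , _ , S⊆Q , e₁∈Q =
        preimage-no-three Q k∈Q e₁∈Q (S⊆Q e₂ (inj₁ refl)) Pk Pe₁ Pe₂
          (avoids⇒≢ K avoids k∈K (joins⇒inc₁ j₁)) (avoids⇒≢ K avoids k∈K (joins⇒inc₁ j₂)) e₁≢e₂

    clean-step : ∀ {x y e} → Joins G e x y → x ≢ u → y ≢ u → Clean x → Clean y
    clean-step {x} {y} jxy x≢u y≢u clean-x = rooted⇒clean go
      where
      go : ∀ (K : Cycle y) → Avoids K u → ∀ {k} → k ∈Eᶜ K → ¬ Pre k
      go K avoids k∈K with em {x ∈Vᶜ K}
      ... | yes x∈K = clean-x K x∈K avoids k∈K
      ... | no x∉K
        with path-onto u y (path K) x≢u (joins⇒≢ jxy) (avoids _ (end∈ (path K))) (joins⇒≢ (closing-joins K))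
      ... | c , c∈K , S , S-path , S-avoids , S∩K
        with reroute K jxy x∉K c∈K (proj₂ (S-avoids c (end∈ S))) S S-path S∩K k∈K
      ... | Q , k∈Q , Q⊆S∪K , _ = clean-x Q (start∈ (path Q)) Q-avoids k∈Q
        where
        Q-avoids : Avoids Q u
        Q-avoids v h with Q⊆S∪K v h
        ... | inj₁ h′ = proj₁ (S-avoids v h′)
        ... | inj₂ h′ = avoids v h′

    clean-along : ∀ {a b} (p : Walk a b) → (∀ v → v ∈V p → v ≢ u) → Clean a → Clean b
    clean-along (nil a) _ clean-a = clean-a
    clean-along (step {a} {b} e j p) avoids clean-a =
      clean-along p (λ v h → avoids v (inj₂ h)) (clean-step j (avoids a (inj₁ refl)) (avoids b (inj₂ (start∈ p))) clean-a)

    clean : ∀ z → z ≢ u → Clean z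
    clean z z≢u with path-avoiding u u v₁≢u v₁≢u z≢u z≢u
    ... | p , _ , avoids = clean-along p (λ v h → proj₁ (avoids v h)) clean-v₁

    preimage-at-u : ∀ {k} → Pre k → Inc G k u
    preimage-at-u {k} Pk with em {end₁ G k ≡ u} | em {end₂ G k ≡ u}
    ... | yes a≡u | _ = inj₁ a≡u
    ... | no _ | yes b≡u = inj₂ b≡u
    ... | no a≢u | no b≢u with cycle-avoiding u (endpoints k) a≢u b≢u
    ... | c , k∈c , avoids = ⊥-elim (clean (end₁ G k) a≢u c (start∈ (path c)) avoids k∈c Pk)

    -- On the cycle u –e– x ⋯ v₁ –e₁– u the partner of e₁ must be e, as no other edge meets u.
    star-at-u : ∀ {e} → Inc G e u → Pre e
    star-at-u {e} ie with inc⇒joins ie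
    ... | x , jx with em {x ≡ v₁}
    ... | yes refl = subst Pre (simple G e₁ e u v₁ j₁ jx) Pe₁
    ... | no x≢v₁ with path-avoiding u u (λ x≡u → joins⇒≢ jx (sym x≡u)) (λ x≡u → joins⇒≢ jx (sym x≡u)) v₁≢u v₁≢u
    ... | p , p-path , p-avoids
      with preimage-partner (cycle (step e jx p) ((λ h → proj₁ (p-avoids u h) refl) , p-path)
                                   (s≤s (≢⇒1≤length p x≢v₁)) e₁ (joins-sym j₁)) (inj₂ refl) Pe₁
    ... | b , inj₂ b≡e₁ , _ , b≢e₁ = ⊥-elim (b≢e₁ b≡e₁)
    ... | b , inj₁ (inj₁ refl) , Pb , _ = Pb
    ... | b , inj₁ (inj₂ b∈p) , Pb , _ with ∈E⇒joins p b∈p | preimage-at-u Pb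
    ... | y , z , jb , y∈p , z∈p | ib with inc⇒endpoint jb ib
    ... | inj₁ u≡y = ⊥-elim (proj₁ (p-avoids y y∈p) (sym u≡y))
    ... | inj₂ u≡z = ⊥-elim (proj₁ (p-avoids z z∈p) (sym u≡z))

    preimage⇔star : ∀ e → Pre e ⇔ Star G u e
    preimage⇔star e = mk⇔ preimage-at-u star-at-u

  star-or-independent : (∃[ v ] (∀ e → Pre e ⇔ Star G v e)) ⊎ Independent G Pre
  star-or-independent with em {∃[ a ] ∃[ b ] (Pre a × Pre b × a ≢ b × ∃[ u ] (Inc G a u × Inc G b u))}
  ... | no none = inj₂ λ a b Pa Pb a≢b u ia ib → none (a , b , Pa , Pb , a≢b , u , ia , ib)
  ... | yes (a , b , Pa , Pb , a≢b , u , ia , ib) =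
    inj₁ (u , AtSharedVertex.preimage⇔star (proj₂ (inc⇒joins ia)) (proj₂ (inc⇒joins ib)) Pa Pb a≢b)

theorem2 : (∀ {ℓ} → ExcludedMiddle ℓ) → (G G' : Graph) → KConnected 3 G →
    (f : E G → E G') → CircuitInjectionOnto G G' f → (w : V G') →
    (∃[ v ] (∀ e → Preimage G G' f (Star G' w) e ⇔ Star G v e))
    ⊎ Independent G (Preimage G G' f (Star G' w))
theorem2 em G G' conn _ ci w = StarPreimage.star-or-independent em G G' conn ci w
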